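{- The set $F_{even}$ is the disjoint union of $\mathbb{N}\setminus B_2$ and the set $\{2\lfloor n\phi\rfloor+n+1 : n\ge0\}$.
   Context: $\mathbb{N}$ denotes the positive integers. $F_i$ are the Fibonacci numbers ($F_0=0,F_1=1,F_{m+1}=F_m+F_{m-1}$), $\phi=(1+\sqrt5)/2$. Zeckendorf representation: every positive integer is uniquely a sum of Fibonacci numbers $F_i$ with distinct indices $i\ge2$, no two consecutive; $A_k$ is the set of positive integers whose Zeckendorf representation has smallest index $k$, and $F_{even}=\bigcup_{k\ge1}A_{2k}$. Chung–Graham representation: every nonnegative integer $n$ is uniquely $n=\sum_{j\ge1}c_jF_{2j}$ with $c_j\in\{0,1,2\}$ such that whenever $j<j'$ and $c_j=c_{j'}=2$ there is $j''$ with $j<j''<j'$ and $c_{j''}=0$. $B_2$ is the set of positive integers whose Chung–Graham representation has $c_1\neq0$. -}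

module Defs where

open import Data.Nat using (ℕ; zero; suc; _+_; _*_; _∸_; _≤_; _<_)
open import Data.List using (List; []; _∷_; map)
open import Data.Nat.ListAction using (sum)
open import Data.Product using (Σ; _×_; ∃-syntax)
open import Data.Unit using (⊤)
open import Relation.Binary.PropositionalEquality using (_≡_; _≢_)
open import Relation.Nullary using (¬_)

fib : ℕ → ℕ
fib zero = 0
fib (suc zero) = 1
fib (suc (suc m)) = fib (suc m) + fib m

-- Zeckendorf representations: a list of indices i₁ < i₂ < … listed in
-- increasing order, all ≥ 2, consecutive ones differing by ≥ 2.

ZGaps : ℕ → List ℕ → Set
ZGaps i [] = ⊤
ZGaps i (j ∷ js) = (i + 2 ≤ j) × ZGaps j js

ZeckValid : List ℕ → Set
ZeckValid [] = ⊤
ZeckValid (i ∷ is) = (2 ≤ i) × ZGaps i is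

zval : List ℕ → ℕ
zval is = sum (map fib is)

-- n ∈ A_k : the Zeckendorf representation of n has smallest index k
-- (k is the head of the increasing index list)
InA : ℕ → ℕ → Set
InA k n = 1 ≤ n × ∃[ rest ] (ZeckValid (k ∷ rest) × zval (k ∷ rest) ≡ n)

InFeven : ℕ → Set
InFeven n = ∃[ k ] (1 ≤ k × InA (2 * k) n)

-- Chung–Graham representations: digit list (c₁, c₂, …, c_L), with
-- c_j = 0 for j > L.

-- c_j for j ≥ 1 (1-indexed); 0 beyond the list (and for j = 0)
digitAt : List ℕ → ℕ → ℕ
digitAt [] j = 0
digitAt (c ∷ cs) zero = 0
digitAt (c ∷ cs) (suc zero) = c
digitAt (c ∷ cs) (suc (suc j)) = digitAt cs (suc j)

AllLe2 : List ℕ → Set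
AllLe2 [] = ⊤
AllLe2 (c ∷ cs) = (c ≤ 2) × AllLe2 cs

cgvalFrom : ℕ → List ℕ → ℕ
cgvalFrom j [] = 0
cgvalFrom j (c ∷ cs) = c * fib (2 * j) + cgvalFrom (suc j) cs

cgval : List ℕ → ℕ
cgval cs = cgvalFrom 1 cs

CGCond : List ℕ → Set
CGCond cs = ∀ j j' → 1 ≤ j → j < j' → digitAt cs j ≡ 2 → digitAt cs j' ≡ 2 →
            ∃[ j'' ] (j < j'' × j'' < j' × digitAt cs j'' ≡ 0)

CGValid : List ℕ → Set
CGValid cs = AllLe2 cs × CGCond cs

InB2 : ℕ → Set
InB2 n = 1 ≤ n × ∃[ cs ] (CGValid cs × cgval cs ≡ n × digitAt cs 1 ≢ 0)

-- ⌊ n φ ⌋ = m, φ = (1 + √5)/2, characterised without reals: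
--   m ≤ nφ      ⇔ 2m ≤ n + n√5 ⇔ (2m ∸ n)² ≤ 5n²
--   nφ < m + 1  ⇔ n + n√5 < 2m + 2 ⇔ n < 2m + 2 and 5n² < (2m + 2 ∸ n)²
IsFloorNPhi : ℕ → ℕ → Set
IsFloorNPhi n m =
  ((2 * m ∸ n) * (2 * m ∸ n) ≤ 5 * (n * n)) ×
  (n < 2 * m + 2 × 5 * (n * n) < (2 * m + 2 ∸ n) * (2 * m + 2 ∸ n))

InS : ℕ → Set
InS x = ∃[ n ] ∃[ m ] (IsFloorNPhi n m × x ≡ 2 * m + n + 1)

-- x ∈ ℕ ∖ B₂ (ℕ = positive integers)
InNotB2 : ℕ → Set
InNotB2 x = 1 ≤ x × ¬ InB2 x

{-# OPTIONS --safe #-}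
-- Every x ≥ 1 is located by the fractional part of x φ, which at level N is approximated by
-- x F_{N+5} / F_{N+4}, and each set of the theorem is an interval for it. Summing d'Ocagne's
-- identity F_{k+1} F_L − F_k F_{L+1} = (−1)ᵏ F_{L−k} over a Zeckendorf representation, whose
-- alternating sum is dominated by its leading term, puts x in (φ⁻², 1) when the smallest index is
-- even and in (0, φ⁻²) when it is odd. The same identity at the even indices of a Chung–Graham
-- representation puts x in (φ⁻¹, 1] when c₁ = 0 and in (0, φ⁻¹] otherwise. Finally
-- x = 2⌊nφ⌋ + n + 1 exactly when the fractional part lies in (φ⁻², φ⁻¹], and the theorem becomes
-- the partition (φ⁻², 1) = (φ⁻², φ⁻¹] ⊔ (φ⁻¹, 1). All bounds hold for every sufficiently large
-- level; Cassini's identity, which puts F_{N+5} / F_{N+4} alternately below and above φ, turns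
-- such eventual bounds into statements about φ itself.

module Submission where

open import Defs
open import Data.Bool using (Bool; true; false; not)
open import Data.Empty using (⊥; ⊥-elim)
open import Data.List using (List; []; _∷_; _++_; [_]; length; map)
open import Data.List.Properties using (length-++; map-++)
import Data.List.Relation.Unary.All as All
open All using (All; []; _∷_)
open import Data.List.Relation.Unary.All.Properties using (++⁺)
open import Data.Nat
open import Data.Nat.ListAction.Properties using (sum-++)
open import Data.Nat.Properties
open import Data.Nat.Tactic.RingSolver using (solve-∀)
open import Data.Product using (∃; ∃-syntax; _×_; _,_; proj₁; proj₂; uncurry)
open import Data.Sum using (_⊎_; inj₁; inj₂)
open import Data.Unit using (tt)
open import Function using (_∘_; case_of_)
open import Function.Bundles using (_⇔_; mk⇔; Equivalence)
open import Relation.Binary using (tri<; tri≈; tri>)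
open import Relation.Binary.PropositionalEquality
  using (_≡_; _≢_; refl; sym; trans; cong; cong₂; subst; subst₂; module ≡-Reasoning)
open import Relation.Nullary using (¬_; yes; no; contradiction)
open Equivalence using (to; from)
open import Algebra.Properties.CommutativeSemigroup +-commutativeSemigroup
  using (x∙yz≈y∙xz; xy∙z≈xz∙y; xy∙z≈zy∙x; x∙yz≈xz∙y)

n≤m<n+o⇒m∸n<o : ∀ {m n o} → n ≤ m → m < n + o → m ∸ n < o
n≤m<n+o⇒m∸n<o {m} {n} {o} n≤m m<n+o =
  +-cancelʳ-< n (m ∸ n) o (subst₂ _<_ (sym (m∸n+n≡m n≤m)) (+-comm n o) m<n+o)

between-by-offset : ∀ {X Y P Q h} → X + P ≡ Y + Q → P < Q → Q < P + h → Y < X × X < Y + h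
between-by-offset {X} {Y} {P} {Q} {h} X+P≡Y+Q P<Q Q<P+h =
  +-cancelʳ-< Q Y X (subst (_< X + Q) X+P≡Y+Q (+-monoʳ-< X P<Q)) ,
  +-cancelʳ-< P X (Y + h) (begin-strict
    X + P       ≡⟨ X+P≡Y+Q ⟩
    Y + Q       <⟨ +-monoʳ-< Y Q<P+h ⟩
    Y + (P + h) ≡⟨ x∙yz≈xz∙y Y P h ⟩
    Y + h + P   ∎)
  where open ≤-Reasoning

shifted-within : ∀ {X Y D r h} → X + D ≡ Y + r → D < r → r ≤ h → Y < X × X ≤ Y + h
shifted-within {X} {Y} {D} {r} {h} X+D≡Y+r D<r r≤h =
  +-cancelʳ-< D Y X (subst (Y + D <_) (sym X+D≡Y+r) (+-monoʳ-< Y D<r)) ,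
  ≤-trans (m≤m+n X D) (≤-trans (≤-reflexive X+D≡Y+r) (+-monoʳ-≤ Y r≤h))

Eventually : (ℕ → Set) → Set
Eventually P = ∃[ K ] (∀ N → K ≤ N → P N)

eventually-∧ : ∀ {P Q : ℕ → Set} → Eventually P → Eventually Q → Eventually (λ N → P N × Q N)
eventually-∧ (K₁ , p) (K₂ , q) =
  K₁ ⊔ K₂ , λ N K≤N → p N (≤-trans (m≤m⊔n K₁ K₂) K≤N) , q N (≤-trans (m≤n⊔m K₁ K₂) K≤N)

eventually-map : ∀ {P Q : ℕ → Set} → (∀ {N} → P N → Q N) → Eventually P → Eventually Q
eventually-map f (K , p) = K , λ N K≤N → f (p N K≤N)

eventually-witness : ∀ {P : ℕ → Set} → Eventually P → ∃ P
eventually-witness (K , p) = K , p K ≤-refl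

eventually-offset : ∀ {P : ℕ → Set} k → Eventually P → Eventually (P ∘ (k +_))
eventually-offset k (K , p) = K , λ N K≤N → p (k + N) (≤-trans K≤N (m≤n+m N k))

eventually-unoffset : ∀ {P : ℕ → Set} k → Eventually (P ∘ (k +_)) → Eventually P
eventually-unoffset {P} k (K , p) = K + k , λ N K+k≤N →
  subst P (m+[n∸m]≡n (≤-trans (m≤n+m k K) K+k≤N)) (p (N ∸ k) (m+n≤o⇒m≤o∸n K K+k≤N))

-- Fibonacci numbers, parity and d'Ocagne's identity

fib-pos : ∀ n → 0 < fib (suc n)
fib-pos zero = s≤s z≤n
fib-pos (suc n) = ≤-trans (fib-pos n) (m≤m+n _ _)

fib-≤-suc : ∀ n → fib n ≤ fib (suc n)
fib-≤-suc zero = z≤n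
fib-≤-suc (suc n) = m≤m+n _ _

fib-mono-≤′ : ∀ {m n} → m ≤′ n → fib m ≤ fib n
fib-mono-≤′ ≤′-refl = ≤-refl
fib-mono-≤′ (≤′-step {n} m≤′n) = ≤-trans (fib-mono-≤′ m≤′n) (fib-≤-suc n)

fib-mono : ∀ {m n} → m ≤ n → fib m ≤ fib n
fib-mono = fib-mono-≤′ ∘ ≤⇒≤′

fib-<-suc : ∀ n → fib (2 + n) < fib (3 + n)
fib-<-suc n = m<m+n (fib (2 + n)) (fib-pos n)

n<fib[2+n] : ∀ n → n < fib (2 + n)
n<fib[2+n] zero = s≤s z≤n
n<fib[2+n] (suc n) = ≤-trans (+-mono-≤ (fib-pos n) (n<fib[2+n] n)) (≤-reflexive (+-comm (fib (suc n)) _))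

n≤fib[n]+1 : ∀ n → n ≤ fib n + 1
n≤fib[n]+1 zero = z≤n
n≤fib[n]+1 (suc zero) = s≤s z≤n
n≤fib[n]+1 (suc (suc n)) = ≤-trans (≤-reflexive (+-comm 1 (suc n))) (+-monoˡ-≤ 1 (n<fib[2+n] n))

even : ℕ → Bool
even zero = true
even (suc zero) = false
even (suc (suc n)) = even n

even-suc : ∀ n → even (suc n) ≡ not (even n)
even-suc zero = refl
even-suc (suc zero) = refl
even-suc (suc (suc n)) = even-suc n

even-2* : ∀ h → even (2 * h) ≡ true
even-2* zero = refl
even-2* (suc h) rewrite +-suc h (h + 0) = even-2* h

even-1+2* : ∀ h → even (suc (2 * h)) ≡ false
even-1+2* h rewrite even-suc (2 * h) | even-2* h = refl

even⇒2* : ∀ k → even k ≡ true → ∃[ h ] k ≡ 2 * h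
even⇒2* zero _ = 0 , refl
even⇒2* (suc (suc k)) e with even⇒2* k e
... | h , refl = suc h , cong suc (sym (+-suc h (h + 0)))

-- a − b = ± c, the sign being + exactly when the flag is true
SignedDiff : Bool → ℕ → ℕ → ℕ → Set
SignedDiff true  a b c = a ≡ b + c
SignedDiff false a b c = a + c ≡ b

SignedDiff-cong : ∀ e {a a′ b b′ c} → a ≡ a′ → b ≡ b′ → SignedDiff e a b c → SignedDiff e a′ b′ c
SignedDiff-cong true refl refl d = d
SignedDiff-cong false refl refl d = d

d'Ocagne-step : ∀ e a b p q c → SignedDiff e (b * p) (a * q) c →
                SignedDiff (not e) ((b + a) * q) (b * (q + p)) c
d'Ocagne-step true a b p q c d = begin
  (b + a) * q + c     ≡⟨ cong (_+ c) (*-distribʳ-+ q b a) ⟩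
  b * q + a * q + c   ≡⟨ +-assoc (b * q) (a * q) c ⟩
  b * q + (a * q + c) ≡⟨ cong (b * q +_) (sym d) ⟩
  b * q + b * p       ≡⟨ sym (*-distribˡ-+ b q p) ⟩
  b * (q + p)         ∎
  where open ≡-Reasoning
d'Ocagne-step false a b p q c d = begin
  (b + a) * q         ≡⟨ *-distribʳ-+ q b a ⟩
  b * q + a * q       ≡⟨ cong (b * q +_) (sym d) ⟩
  b * q + (b * p + c) ≡⟨ sym (+-assoc (b * q) (b * p) c) ⟩
  b * q + b * p + c   ≡⟨ cong (_+ c) (sym (*-distribˡ-+ b q p)) ⟩
  b * (q + p) + c     ∎
  where open ≡-Reasoning

d'Ocagne : ∀ k t → SignedDiff (even k) (fib (suc k) * fib (k + t)) (fib k * fib (suc (k + t))) (fib t)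
d'Ocagne zero t = +-identityʳ (fib t)
d'Ocagne (suc k) t rewrite even-suc k =
  d'Ocagne-step (even k) (fib k) (fib (suc k)) (fib (k + t)) (fib (suc (k + t))) (fib t) (d'Ocagne k t)

cassini : ∀ j → SignedDiff (even j) (fib (suc j) * fib (suc j)) (fib (suc j) * fib j + fib j * fib j) 1
cassini j = SignedDiff-cong (even j) (cong (λ i → fib (suc j) * fib i) (+-comm j 1)) rhs (d'Ocagne j 1)
  where
  rhs : fib j * fib (suc (j + 1)) ≡ fib (suc j) * fib j + fib j * fib j
  rhs rewrite +-comm j 1 | *-distribˡ-+ (fib j) (fib (suc j)) (fib j) = cong (_+ fib j * fib j) (*-comm (fib j) _)

-- Comparison with φ and the floor of n φ

-- a ≤ φ b, a ≥ φ b and a > φ b, squared using φ² = φ + 1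
_≤φ·_ _≥φ·_ _>φ·_ : ℕ → ℕ → Set
a ≤φ· b = a * a ≤ a * b + b * b
a ≥φ· b = a * b + b * b ≤ a * a
a >φ· b = a * b + b * b < a * a

≤φ·-antitone : ∀ {a b c} → a ≤ b → b ≤φ· c → a ≤φ· c
≤φ·-antitone {a} {b} {c} a≤b b≤φc with a ≤? c
... | yes a≤c = ≤-trans (*-monoʳ-≤ a a≤c) (m≤m+n (a * c) (c * c))
... | no a≰c with m≤n⇒∃[o]m+o≡n (<⇒≤ (≰⇒> a≰c))
... | d , refl with m≤n⇒∃[o]m+o≡n a≤b
... | e , refl = begin
  (c + d) * (c + d)         ≡⟨ *-distribˡ-+ (c + d) c d ⟩
  (c + d) * c + (c + d) * d ≤⟨ +-monoʳ-≤ ((c + d) * c) (≤-trans (*-mono-≤ (m≤m+n (c + d) e) (m≤m+n d e))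
                                                              excess) ⟩
  (c + d) * c + c * c       ∎
  where
  open ≤-Reasoning
  excess : (c + d + e) * (d + e) ≤ c * c
  excess = +-cancelˡ-≤ ((c + d + e) * c) _ _ (≤-trans (≤-reflexive (split c d e)) b≤φc)
    where
    split : ∀ c d e → (c + d + e) * c + (c + d + e) * (d + e) ≡ (c + d + e) * (c + d + e)
    split = solve-∀

>φ·-monotone : ∀ {a b c} → c ≤ b → b ≥φ· c → b < a → a >φ· c
>φ·-monotone {a} {b} {c} c≤b b≥φc b<a with m≤n⇒∃[o]m+o≡n c≤b
... | e , refl with m≤n⇒∃[o]m+o≡n (<⇒≤ b<a)
... | d , refl = begin-strict
  (c + e + d) * c + c * c       <⟨ +-monoʳ-< ((c + e + d) * c) (≤-<-trans deficit growth) ⟩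
  (c + e + d) * c + (c + e + d) * (e + d) ≡⟨ split c e d ⟩
  (c + e + d) * (c + e + d)     ∎
  where
  open ≤-Reasoning
  d>0 : 0 < d
  d>0 = +-cancelˡ-< (c + e) 0 d (subst (_< c + e + d) (sym (+-identityʳ (c + e))) b<a)
  deficit : c * c ≤ (c + e) * e
  deficit = +-cancelˡ-≤ ((c + e) * c) _ _ (≤-trans b≥φc (≤-reflexive (*-distribˡ-+ (c + e) c e)))
  growth : (c + e) * e < (c + e + d) * (e + d)
  growth = *-mono-< (m<m+n (c + e) d>0) (m<m+n e d>0)
  split : ∀ c e d → (c + e + d) * c + (c + e + d) * (e + d) ≡ (c + e + d) * (c + e + d)
  split = solve-∀

square-*ʳ : ∀ a k → (a * k) * (a * k) ≡ a * a * (k * k)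
square-*ʳ = solve-∀

form-*ʳ : ∀ a b k → (a * k) * (b * k) + (b * k) * (b * k) ≡ (a * b + b * b) * (k * k)
form-*ʳ = solve-∀

square-*ˡ : ∀ n a → n * n * (a * a) ≡ (n * a) * (n * a)
square-*ˡ = solve-∀

form-*ˡ : ∀ n a b → n * n * (a * b + b * b) ≡ (n * a) * (n * b) + (n * b) * (n * b)
form-*ˡ = solve-∀

≤φ·-cancelʳ : ∀ {a b} k → 0 < k → (a * k) ≤φ· (b * k) → a ≤φ· b
≤φ·-cancelʳ {a} {b} k k>0 h = *-cancelʳ-≤ (a * a) (a * b + b * b) (k * k) {{>-nonZero (*-mono-< k>0 k>0)}}
  (subst₂ _≤_ (square-*ʳ a k) (form-*ʳ a b k) h)

>φ·-cancelʳ : ∀ {a b} k → (a * k) >φ· (b * k) → a >φ· b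
>φ·-cancelʳ {a} {b} k h = *-cancelʳ-< (k * k) (a * b + b * b) (a * a) (subst₂ _<_ (form-*ʳ a b k) (square-*ʳ a k) h)

≤φ·-*ˡ : ∀ {a b} n → a ≤φ· b → (n * a) ≤φ· (n * b)
≤φ·-*ˡ {a} {b} n h = subst₂ _≤_ (square-*ˡ n a) (form-*ˡ n a b) (*-monoʳ-≤ (n * n) h)

≥φ·-*ˡ : ∀ {a b} n → a ≥φ· b → (n * a) ≥φ· (n * b)
≥φ·-*ˡ {a} {b} n h = subst₂ _≤_ (form-*ˡ n a b) (square-*ˡ n a) (*-monoʳ-≤ (n * n) h)

fib-odd-≤φ· : ∀ j → even j ≡ false → fib (suc j) ≤φ· fib j
fib-odd-≤φ· j odd with even j | cassini j | odd
... | false | F′²+1≡F′F+F² | refl = ≤-trans (m≤m+n _ 1) (≤-reflexive F′²+1≡F′F+F²)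

fib-even-≥φ· : ∀ j → even j ≡ true → fib (suc j) ≥φ· fib j
fib-even-≥φ· j ev with even j | cassini j | ev
... | true | F′²≡F′F+F²+1 | refl = ≤-trans (m≤m+n _ 1) (≤-reflexive (sym F′²≡F′F+F²+1))

-- with d = 2m − n, this makes m ≤ φ n equivalent to d² ≤ 5n², the form used by IsFloorNPhi
golden-discriminant : ∀ {d m n} → d + n ≡ 2 * m → d * d + 4 * (m * n + n * n) ≡ 4 * (m * m) + 5 * (n * n)
golden-discriminant {d} {m} {n} d+n≡2m = begin
  d * d + 4 * (m * n + n * n)              ≡⟨ halve m n d ⟩
  d * d + 2 * ((2 * m) * n) + 4 * (n * n)  ≡⟨ cong (λ z → d * d + 2 * (z * n) + 4 * (n * n)) (sym d+n≡2m) ⟩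
  d * d + 2 * ((d + n) * n) + 4 * (n * n)  ≡⟨ complete d n ⟩
  (d + n) * (d + n) + 5 * (n * n)          ≡⟨ cong (λ z → z * z + 5 * (n * n)) d+n≡2m ⟩
  (2 * m) * (2 * m) + 5 * (n * n)          ≡⟨ double m n ⟩
  4 * (m * m) + 5 * (n * n)                ∎
  where
  open ≡-Reasoning
  halve : ∀ m n d → d * d + 4 * (m * n + n * n) ≡ d * d + 2 * ((2 * m) * n) + 4 * (n * n)
  halve = solve-∀
  complete : ∀ d n → d * d + 2 * ((d + n) * n) + 4 * (n * n) ≡ (d + n) * (d + n) + 5 * (n * n)
  complete = solve-∀
  double : ∀ m n → (2 * m) * (2 * m) + 5 * (n * n) ≡ 4 * (m * m) + 5 * (n * n)
  double = solve-∀

≤φ·⇒floor-lower : ∀ {m n} → m ≤φ· n → (2 * m ∸ n) * (2 * m ∸ n) ≤ 5 * (n * n)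
≤φ·⇒floor-lower {m} {n} h with 2 * m ≤? n
... | yes 2m≤n rewrite m≤n⇒m∸n≡0 2m≤n = z≤n
... | no 2m≰n = +-cancelʳ-≤ (4 * (m * n + n * n)) _ _ (begin
  d * d + 4 * (m * n + n * n)           ≡⟨ golden-discriminant {d} {m} {n} (m∸n+n≡m (<⇒≤ (≰⇒> 2m≰n))) ⟩
  4 * (m * m) + 5 * (n * n)             ≤⟨ +-monoˡ-≤ (5 * (n * n)) (*-monoʳ-≤ 4 h) ⟩
  4 * (m * n + n * n) + 5 * (n * n)     ≡⟨ +-comm (4 * (m * n + n * n)) _ ⟩
  5 * (n * n) + 4 * (m * n + n * n)     ∎)
  where
  open ≤-Reasoning
  d = 2 * m ∸ n

>φ·⇒floor-upper : ∀ {m n} → m >φ· n → n < 2 * m × 5 * (n * n) < (2 * m ∸ n) * (2 * m ∸ n)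
>φ·⇒floor-upper {m} {n} h = n<2m , +-cancelˡ-< (4 * (m * n + n * n)) _ _ (begin-strict
  4 * (m * n + n * n) + 5 * (n * n)     <⟨ +-monoˡ-< (5 * (n * n)) (*-monoʳ-< 4 h) ⟩
  4 * (m * m) + 5 * (n * n)             ≡⟨ sym (golden-discriminant {d} {m} {n} (m∸n+n≡m (<⇒≤ n<2m))) ⟩
  d * d + 4 * (m * n + n * n)           ≡⟨ +-comm (d * d) _ ⟩
  4 * (m * n + n * n) + d * d           ∎)
  where
  open ≤-Reasoning
  d = 2 * m ∸ n
  n<m : n < m
  n<m with m ≤? n
  ... | no m≰n = ≰⇒> m≰n
  ... | yes m≤n = contradiction h (≤⇒≯ (≤-trans (*-mono-≤ m≤n m≤n) (m≤n+m (n * n) (m * n))))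
  n<2m : n < 2 * m
  n<2m = ≤-trans n<m (m≤m+n m (m + 0))

2*[1+m]≡2*m+2 : ∀ m → 2 * suc m ≡ 2 * m + 2
2*[1+m]≡2*m+2 m = trans (*-suc 2 m) (+-comm 2 (2 * m))

record ApproxFloor (n m N : ℕ) : Set where
  constructor approxFloor
  field
    lower : m * fib (4 + N) ≤ n * fib (5 + N)
    upper : n * fib (5 + N) < suc m * fib (4 + N)

-- F_{j+1}/F_j lies below φ for odd j and above φ for even j (Cassini), so the
-- lower bound on m is read off at an odd level and the upper one at an even level.
approx⇒IsFloorNPhi : ∀ {n m} → Eventually (ApproxFloor n m) → IsFloorNPhi n m
approx⇒IsFloorNPhi {n} {m} (K , approx) =
  ≤φ·⇒floor-lower {m} {n} m≤φn , subst bounds (2*[1+m]≡2*m+2 m) (>φ·⇒floor-upper {suc m} {n} 1+m>φn)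
  where
  odd = suc (2 * K)
  m≤φn : m ≤φ· n
  m≤φn = ≤φ·-cancelʳ {m} {n} (fib (4 + odd)) (fib-pos (3 + odd))
    (≤φ·-antitone {c = n * fib (4 + odd)} (ApproxFloor.lower (approx odd (≤-trans (m≤m+n K (K + 0)) (n≤1+n _))))
                  (≤φ·-*ˡ {fib (5 + odd)} n (fib-odd-≤φ· (4 + odd) (even-1+2* K))))
  1+m>φn : suc m >φ· n
  1+m>φn = >φ·-cancelʳ {suc m} {n} (fib (4 + 2 * K))
    (>φ·-monotone (*-monoʳ-≤ n (fib-≤-suc (4 + 2 * K)))
                  (≥φ·-*ˡ {fib (5 + 2 * K)} n (fib-even-≥φ· (4 + 2 * K) (even-2* K)))
                  (ApproxFloor.upper (approx (2 * K) (m≤m+n K (K + 0)))))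
  bounds : ℕ → Set
  bounds t = n < t × 5 * (n * n) < (t ∸ n) * (t ∸ n)

IsFloorNPhi-unique : ∀ {n m m′} → IsFloorNPhi n m → IsFloorNPhi n m′ → m ≡ m′
IsFloorNPhi-unique f f′ = ≤-antisym (≮⇒≥ (not-below f′ f)) (≮⇒≥ (not-below f f′))
  where
  not-below : ∀ {n a b} → IsFloorNPhi n a → IsFloorNPhi n b → ¬ a < b
  not-below {n} {a} {b} (_ , _ , a-upper) (b-lower , _) a<b =
    <⇒≱ a-upper (≤-trans (*-mono-≤ 2a+2∸n≤2b∸n 2a+2∸n≤2b∸n) b-lower)
    where
    2a+2∸n≤2b∸n : 2 * a + 2 ∸ n ≤ 2 * b ∸ n
    2a+2∸n≤2b∸n = ∸-monoˡ-≤ n (subst (_≤ 2 * b) (2*[1+m]≡2*m+2 a) (*-monoʳ-≤ 2 a<b))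

-- The fractional part of x φ at level N

-- Cut points in units of 1/F_{N+4}: they tend to 0 < φ⁻² < φ⁻¹ < 1.
Cut : Set
Cut = ℕ → ℕ

⟨0⟩ ⟨φ⁻²⟩ ⟨φ⁻¹⟩ ⟨1⟩ : Cut
⟨0⟩ N = 0
⟨φ⁻²⟩ N = fib (2 + N)
⟨φ⁻¹⟩ N = fib (3 + N)
⟨1⟩ N = fib (4 + N)

_≤ᶜ_ : Cut → Cut → Set
lo ≤ᶜ hi = ∀ N → lo N ≤ hi N

≤ᶜ-refl : ∀ {c} → c ≤ᶜ c
≤ᶜ-refl N = ≤-refl

⟨φ⁻²⟩≤ᶜ⟨φ⁻¹⟩ : ⟨φ⁻²⟩ ≤ᶜ ⟨φ⁻¹⟩
⟨φ⁻²⟩≤ᶜ⟨φ⁻¹⟩ N = fib-≤-suc (2 + N)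

⟨φ⁻¹⟩≤ᶜ⟨1⟩ : ⟨φ⁻¹⟩ ≤ᶜ ⟨1⟩
⟨φ⁻¹⟩≤ᶜ⟨1⟩ N = fib-≤-suc (3 + N)

⟨φ⁻²⟩≤ᶜ⟨1⟩ : ⟨φ⁻²⟩ ≤ᶜ ⟨1⟩
⟨φ⁻²⟩≤ᶜ⟨1⟩ N = ≤-trans (⟨φ⁻²⟩≤ᶜ⟨φ⁻¹⟩ N) (⟨φ⁻¹⟩≤ᶜ⟨1⟩ N)

-- x F_{N+5} / F_{N+4}, which tends to x φ, lies in (M + lo, M + hi] resp. (M + lo, M + hi)
record Within (lo hi : Cut) (x M N : ℕ) : Set where
  constructor within
  field
    above : lo N + M * fib (4 + N) < x * fib (5 + N)
    below : x * fib (5 + N) ≤ hi N + M * fib (4 + N)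

record Within° (lo hi : Cut) (x M N : ℕ) : Set where
  constructor within°
  field
    above : lo N + M * fib (4 + N) < x * fib (5 + N)
    below : x * fib (5 + N) < hi N + M * fib (4 + N)

FracIn FracIn° : Cut → Cut → ℕ → Set
FracIn lo hi x = ∃[ M ] Eventually (Within lo hi x M)
FracIn° lo hi x = ∃[ M ] Eventually (Within° lo hi x M)

FracIn°⇒FracIn : ∀ {lo hi x} → FracIn° lo hi x → FracIn lo hi x
FracIn°⇒FracIn (M , w) = M , eventually-map (λ (within° l u) → within l (<⇒≤ u)) w

FracIn-mono : ∀ {lo lo′ hi hi′ x} → lo′ ≤ᶜ lo → hi ≤ᶜ hi′ → FracIn lo hi x → FracIn lo′ hi′ x
FracIn-mono {lo} {lo′} {hi} {hi′} {x} lo′≤lo hi≤hi′ (M , w) = M , eventually-map widen w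
  where
  widen : ∀ {N} → Within lo hi x M N → Within lo′ hi′ x M N
  widen {N} (within l u) = within (≤-<-trans (+-monoˡ-≤ _ (lo′≤lo N)) l) (≤-trans u (+-monoˡ-≤ _ (hi≤hi′ N)))

FracIn⇒positive : ∀ {lo hi x} → FracIn lo hi x → 1 ≤ x
FracIn⇒positive {x = zero} (M , w) with eventually-witness w
... | _ , within () _
FracIn⇒positive {x = suc x} _ = s≤s z≤n

floor-≤ : ∀ {lo hi X M M′ F} → lo + M * F < X → X ≤ hi + M′ * F → hi ≤ F → M ≤ M′
floor-≤ {lo} {hi} {X} {M} {M′} {F} l u hi≤F = ≤-pred (*-cancelʳ-< F M (suc M′) (begin-strict
  M * F       ≤⟨ m≤n+m (M * F) lo ⟩
  lo + M * F  <⟨ l ⟩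
  X           ≤⟨ u ⟩
  hi + M′ * F ≤⟨ +-monoˡ-≤ (M′ * F) hi≤F ⟩
  F + M′ * F  ∎))
  where open ≤-Reasoning

Within-same-floor : ∀ {lo hi lo′ hi′ x M M′} → hi ≤ᶜ ⟨1⟩ → hi′ ≤ᶜ ⟨1⟩ →
  Eventually (Within lo hi x M) → Eventually (Within lo′ hi′ x M′) → M ≡ M′
Within-same-floor hi≤1 hi′≤1 w w′ with eventually-witness (eventually-∧ w w′)
... | N , within l u , within l′ u′ = ≤-antisym (floor-≤ l u′ (hi′≤1 N)) (floor-≤ l′ u (hi≤1 N))

FracIn-disjoint : ∀ {lo hi lo′ hi′ x} → hi ≤ᶜ ⟨1⟩ → hi′ ≤ᶜ ⟨1⟩ → hi ≤ᶜ lo′ →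
  FracIn lo hi x → FracIn lo′ hi′ x → ⊥
FracIn-disjoint hi≤1 hi′≤1 hi≤lo′ (M , w) (M′ , w′) with Within-same-floor hi≤1 hi′≤1 w w′
... | refl with eventually-witness (eventually-∧ w w′)
... | N , within _ u , within l′ _ = <⇒≱ l′ (≤-trans u (+-monoˡ-≤ (M * fib (4 + N)) (hi≤lo′ N)))

FracIn-∩ : ∀ {lo hi lo′ hi′ x} → hi ≤ᶜ ⟨1⟩ → hi′ ≤ᶜ ⟨1⟩ →
  FracIn lo hi x → FracIn lo′ hi′ x → FracIn lo′ hi x
FracIn-∩ hi≤1 hi′≤1 (M , w) (M′ , w′) with Within-same-floor hi≤1 hi′≤1 w w′
... | refl = M , eventually-map (λ (within _ u , within l′ _) → within l′ u) (eventually-∧ w w′)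

-- Zeckendorf representations

ZGaps-snoc : ∀ {i b} is → ZGaps i is → i + 2 ≤ b → All (λ j → j + 2 ≤ b) is → ZGaps i (is ++ [ b ])
ZGaps-snoc [] _ i+2≤b _ = i+2≤b , tt
ZGaps-snoc (j ∷ js) (i+2≤j , gaps) _ (j+2≤b ∷ js+2≤b) = i+2≤j , ZGaps-snoc js gaps j+2≤b js+2≤b

ZeckValid-snoc : ∀ {b} zs → ZeckValid zs → 2 ≤ b → All (λ j → j + 2 ≤ b) zs → ZeckValid (zs ++ [ b ])
ZeckValid-snoc [] _ 2≤b _ = 2≤b , tt
ZeckValid-snoc (i ∷ is) (2≤i , gaps) _ (i+2≤b ∷ is+2≤b) = 2≤i , ZGaps-snoc is gaps i+2≤b is+2≤b

zval-snoc : ∀ zs b → zval (zs ++ [ b ]) ≡ zval zs + fib b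
zval-snoc zs b rewrite map-++ fib zs [ b ] | sum-++ (map fib zs) [ fib b ] = cong (zval zs +_) (+-identityʳ (fib b))

ZeckendorfBelow : ℕ → Set
ZeckendorfBelow K = ∀ x → x < fib (suc K) → ∃[ zs ] (ZeckValid zs × zval zs ≡ x × All (_≤ K) zs)

zeckendorf-below-step : ∀ K → ZeckendorfBelow (suc K) → ZeckendorfBelow K → ZeckendorfBelow (2 + K)
zeckendorf-below-step K below₁ below₀ x x<F with x <? fib (2 + K)
... | yes x<F′ with below₁ x x<F′
...   | zs , valid , sum , bound = zs , valid , sum , All.map (λ i≤1+K → ≤-trans i≤1+K (n≤1+n _)) bound
zeckendorf-below-step K below₁ below₀ x x<F | no x≮F′
  with below₀ (x ∸ fib (2 + K)) (n≤m<n+o⇒m∸n<o (≮⇒≥ x≮F′) x<F)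
... | zs , valid , sum , bound =
  zs ++ [ 2 + K ] ,
  ZeckValid-snoc zs valid (s≤s (s≤s z≤n))
    (All.map (λ {i} i≤K → ≤-trans (+-monoˡ-≤ 2 i≤K) (≤-reflexive (+-comm K 2))) bound) ,
  trans (zval-snoc zs (2 + K)) (trans (cong (_+ fib (2 + K)) sum) (m∸n+n≡m (≮⇒≥ x≮F′))) ,
  ++⁺ (All.map (λ i≤K → ≤-trans i≤K (≤-trans (n≤1+n K) (n≤1+n (suc K)))) bound) (≤-refl ∷ [])

zeckendorf-below : ∀ K → ZeckendorfBelow K
zeckendorf-below zero zero _ = [] , tt , refl , []
zeckendorf-below (suc zero) zero _ = [] , tt , refl , []
zeckendorf-below zero (suc x) (s≤s ())
zeckendorf-below (suc zero) (suc x) (s≤s ())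
zeckendorf-below (suc (suc K)) = zeckendorf-below-step K (zeckendorf-below (suc K)) (zeckendorf-below K)

zeckendorf-exists : ∀ {x} → 1 ≤ x → ∃[ k ] ∃[ rest ] (ZeckValid (k ∷ rest) × zval (k ∷ rest) ≡ x)
zeckendorf-exists {suc x} _ with zeckendorf-below (suc (suc x)) (suc x) (n<fib[2+n] (suc x))
... | [] , _ , () , _
... | k ∷ rest , valid , sum , _ = k , rest , valid , sum

evenPart oddPart : Bool → ℕ → ℕ
evenPart true t = t
evenPart false _ = 0
oddPart true _ = 0
oddPart false t = t

evenSum oddSum : ℕ → List ℕ → ℕ
evenSum L [] = 0
evenSum L (k ∷ ks) = evenPart (even k) (fib (L ∸ k)) + evenSum L ks
oddSum L [] = 0
oddSum L (k ∷ ks) = oddPart (even k) (fib (L ∸ k)) + oddSum L ks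

SignedDiff⇒balanced : ∀ e {a b c} → SignedDiff e a b c → a + oddPart e c ≡ b + evenPart e c
SignedDiff⇒balanced true {a} d = trans (+-identityʳ a) d
SignedDiff⇒balanced false {b = b} d = trans d (sym (+-identityʳ b))

zval⁺ : List ℕ → ℕ
zval⁺ ks = zval (map suc ks)

-- Σ F_{k+1} · F_L − Σ F_k · F_{L+1} = Σ (−1)ᵏ F_{L−k}, summing d'Ocagne over the indices
zeckendorf-d'Ocagne : ∀ L ks → All (_≤ L) ks →
  zval⁺ ks * fib L + oddSum L ks ≡ zval ks * fib (suc L) + evenSum L ks
zeckendorf-d'Ocagne L [] [] = refl
zeckendorf-d'Ocagne L (k ∷ ks) (k≤L ∷ ks≤L) = begin
  (fib (suc k) + zval⁺ ks) * fib L + (oddPart (even k) (fib (L ∸ k)) + oddSum L ks)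
    ≡⟨ interchange (fib (suc k)) _ (fib L) _ _ ⟩
  (fib (suc k) * fib L + oddPart (even k) (fib (L ∸ k))) + (zval⁺ ks * fib L + oddSum L ks)
    ≡⟨ cong₂ _+_ head (zeckendorf-d'Ocagne L ks ks≤L) ⟩
  (fib k * fib (suc L) + evenPart (even k) (fib (L ∸ k))) + (zval ks * fib (suc L) + evenSum L ks)
    ≡⟨ sym (interchange (fib k) _ (fib (suc L)) _ _) ⟩
  (fib k + zval ks) * fib (suc L) + (evenPart (even k) (fib (L ∸ k)) + evenSum L ks) ∎
  where
  open ≡-Reasoning
  interchange : ∀ a b F c d → (a + b) * F + (c + d) ≡ (a * F + c) + (b * F + d)
  interchange = solve-∀
  head : fib (suc k) * fib L + oddPart (even k) (fib (L ∸ k)) ≡ fib k * fib (suc L) + evenPart (even k) (fib (L ∸ k))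
  head = SignedDiff⇒balanced (even k)
    (subst (λ l → SignedDiff (even k) (fib (suc k) * fib l) (fib k * fib (suc l)) (fib (L ∸ k)))
           (m+[n∸m]≡n k≤L) (d'Ocagne k (L ∸ k)))

SignedBetween : Bool → ℕ → ℕ → ℕ → ℕ → Set
SignedBetween true  lo hi P Q = Q + lo < P × P < Q + hi
SignedBetween false lo hi P Q = P + lo < Q × Q < P + hi

-- a signed sum ±F_j ± … whose indices drop by at least 2 is dominated by its leading term
Leads : Bool → ℕ → ℕ → ℕ → Set
Leads b j = SignedBetween b (fib (pred j)) (fib (suc j))

leads-single : ∀ b {j} → 3 ≤ j → Leads b j (evenPart b (fib j) + 0) (oddPart b (fib j) + 0)
leads-single true (s≤s (s≤s (s≤s {n = u} _))) rewrite +-identityʳ (fib (3 + u)) = fib-<-suc u , fib-<-suc (suc u)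
leads-single false (s≤s (s≤s (s≤s {n = u} _))) rewrite +-identityʳ (fib (3 + u)) = fib-<-suc u , fib-<-suc (suc u)

leads-extend-same : ∀ {j j′ P Q} → 2 + j′ ≤ j → Leads true j′ P Q → Leads true j (fib j + P) Q
leads-extend-same {suc i} {j′} {P} {Q} (s≤s 1+j′≤i) (lower , upper) = lower′ , upper′
  where
  open ≤-Reasoning
  lower′ : Q + fib i < fib (suc i) + P
  lower′ = begin-strict
    Q + fib i       ≤⟨ +-monoʳ-≤ Q (fib-≤-suc i) ⟩
    Q + fib (suc i) ≡⟨ +-comm Q _ ⟩
    fib (suc i) + Q <⟨ +-monoʳ-< (fib (suc i)) (≤-<-trans (m≤m+n Q _) lower) ⟩
    fib (suc i) + P ∎
  upper′ : fib (suc i) + P < Q + (fib (suc i) + fib i)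
  upper′ = begin-strict
    fib (suc i) + P               <⟨ +-monoʳ-< (fib (suc i)) (<-≤-trans upper (+-monoʳ-≤ Q (fib-mono 1+j′≤i))) ⟩
    fib (suc i) + (Q + fib i)     ≡⟨ x∙yz≈y∙xz (fib (suc i)) Q (fib i) ⟩
    Q + (fib (suc i) + fib i)     ∎

leads-extend-opposite : ∀ {j j′ P Q} → 3 + j′ ≤ j → Leads true j′ Q P → Leads true j (fib j + P) Q
leads-extend-opposite {suc (suc i)} {j′} {P} {Q} (s≤s (s≤s 1+j′≤i)) (lower , upper) = lower′ , upper′
  where
  open ≤-Reasoning
  lower′ : Q + fib (suc i) < fib (suc i) + fib i + P
  lower′ = begin-strict
    Q + fib (suc i)               <⟨ +-monoˡ-< (fib (suc i)) (<-≤-trans upper (+-monoʳ-≤ P (fib-mono 1+j′≤i))) ⟩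
    P + fib i + fib (suc i)       ≡⟨ xy∙z≈zy∙x P (fib i) (fib (suc i)) ⟩
    fib (suc i) + fib i + P       ∎
  upper′ : fib (2 + i) + P < Q + fib (3 + i)
  upper′ = begin-strict
    fib (2 + i) + P <⟨ +-monoʳ-< (fib (2 + i)) (≤-<-trans (m≤m+n P _) lower) ⟩
    fib (2 + i) + Q ≤⟨ +-monoˡ-≤ Q (fib-≤-suc (2 + i)) ⟩
    fib (3 + i) + Q ≡⟨ +-comm (fib (3 + i)) Q ⟩
    Q + fib (3 + i) ∎

leads-cons : ∀ b b′ {j j′ P Q} → (b ≡ b′ → 2 + j′ ≤ j) → (b ≢ b′ → 3 + j′ ≤ j) → Leads b′ j′ P Q →
  Leads b j (evenPart b (fib j) + P) (oddPart b (fib j) + Q)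
leads-cons true true same _ = leads-extend-same (same refl)
leads-cons false false same _ = leads-extend-same (same refl)
leads-cons true false _ opposite = leads-extend-opposite (opposite λ ())
leads-cons false true _ opposite = leads-extend-opposite (opposite λ ())

gap-∸ : ∀ {d k k′ L} → k + d ≤ k′ → k′ ≤ L → d + (L ∸ k′) ≤ L ∸ k
gap-∸ {d} {k} {k′} {L} k+d≤k′ k′≤L = begin
  d + (L ∸ k′)        ≤⟨ +-monoˡ-≤ (L ∸ k′) (m+n≤o⇒m≤o∸n d (subst (_≤ k′) (+-comm k d) k+d≤k′)) ⟩
  (k′ ∸ k) + (L ∸ k′) ≡⟨ sym (+-∸-comm (L ∸ k′) (≤-trans (m≤m+n k d) k+d≤k′)) ⟩
  (k′ + (L ∸ k′)) ∸ k ≡⟨ cong (_∸ k) (m+[n∸m]≡n k′≤L) ⟩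
  L ∸ k               ∎
  where open ≤-Reasoning

zeckendorf-leads : ∀ L k ks → ZGaps k ks → All (λ i → i + 3 ≤ L) (k ∷ ks) →
  Leads (even k) (L ∸ k) (evenSum L (k ∷ ks)) (oddSum L (k ∷ ks))
zeckendorf-leads L k [] _ (k+3≤L ∷ []) = leads-single (even k) (m+n≤o⇒m≤o∸n 3 (subst (_≤ L) (+-comm k 3) k+3≤L))
zeckendorf-leads L k (k′ ∷ ks) (k+2≤k′ , gaps) (_ ∷ bounds@(k′+3≤L ∷ _)) =
  leads-cons (even k) (even k′) (λ _ → gap-∸ k+2≤k′ k′≤L) (λ parities≢ → gap-∸ (k+3≤k′ parities≢) k′≤L)
    (zeckendorf-leads L k′ ks gaps bounds)
  where
  k′≤L : k′ ≤ L
  k′≤L = ≤-trans (m≤m+n k′ 3) k′+3≤L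
  k+3≤k′ : even k ≢ even k′ → k + 3 ≤ k′
  k+3≤k′ parities≢ = subst (_≤ k′) (sym (+-suc k 2)) (≤∧≢⇒< k+2≤k′ λ k+2≡k′ →
    parities≢ (trans (cong even (sym (+-comm k 2))) (cong even k+2≡k′)))

zval-index-bound : ∀ ks → All (λ i → i ≤ zval ks + 1) ks
zval-index-bound [] = []
zval-index-bound (k ∷ ks) =
  ≤-trans (n≤fib[n]+1 k) (+-monoˡ-≤ 1 (m≤m+n (fib k) (zval ks))) ∷
  All.map (λ i≤ → ≤-trans i≤ (+-monoˡ-≤ 1 (m≤n+m (zval ks) (fib k)))) (zval-index-bound ks)

zeckendorf-at-level : ∀ {k rest b} N → ZGaps k rest → even k ≡ b → zval (k ∷ rest) ≤ N →
  zval⁺ (k ∷ rest) * fib (4 + N) + oddSum (4 + N) (k ∷ rest) ≡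
    zval (k ∷ rest) * fib (5 + N) + evenSum (4 + N) (k ∷ rest) ×
  Leads b (4 + N ∸ k) (evenSum (4 + N) (k ∷ rest)) (oddSum (4 + N) (k ∷ rest))
zeckendorf-at-level {k} {rest} N gaps refl x≤N =
  zeckendorf-d'Ocagne (4 + N) (k ∷ rest) (All.map (λ {i} i+3≤L → ≤-trans (m≤m+n i 3) i+3≤L) bounds) ,
  zeckendorf-leads (4 + N) k rest gaps bounds
  where
  regroup : ∀ N → N + 1 + 3 ≡ 4 + N
  regroup = solve-∀
  bounds : All (λ i → i + 3 ≤ 4 + N) (k ∷ rest)
  bounds = All.map (λ i≤x+1 → ≤-trans (+-monoˡ-≤ 3 (≤-trans i≤x+1 (+-monoˡ-≤ 1 x≤N))) (≤-reflexive (regroup N)))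
                   (zval-index-bound (k ∷ rest))

zeckendorf-even-head : ∀ {k rest} → ZeckValid (k ∷ rest) → even k ≡ true → FracIn° ⟨φ⁻²⟩ ⟨1⟩ (zval (k ∷ rest))
zeckendorf-even-head {k} {rest} (2≤k , gaps) even-k = M , x , bounds
  where
  x = zval (k ∷ rest)
  σ = zval⁺ (k ∷ rest)
  M = σ ∸ 1
  σ≡1+M : σ ≡ suc M
  σ≡1+M = sym (m+[n∸m]≡n (≤-trans (fib-pos k) (m≤m+n _ _)))
  bounds : ∀ N → x ≤ N → Within° ⟨φ⁻²⟩ ⟨1⟩ x M N
  bounds N x≤N with zeckendorf-at-level N gaps even-k x≤N
  ... | identity , lower , upper with between-by-offset identity (≤-<-trans (m≤m+n _ _) lower) upper
  ... | xF′<σF , σF<xF′+h = within° lower′ (subst (λ s → x * fib (5 + N) < s * fib (4 + N)) σ≡1+M xF′<σF)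
    where
    open ≤-Reasoning
    F = fib (4 + N)
    lower′ : fib (2 + N) + M * F < x * fib (5 + N)
    lower′ = +-cancelˡ-< (fib (3 + N)) _ _ (begin-strict
      fib (3 + N) + (fib (2 + N) + M * F)     ≡⟨ sym (+-assoc (fib (3 + N)) _ _) ⟩
      suc M * F                               ≡⟨ cong (_* F) (sym σ≡1+M) ⟩
      σ * F                                   <⟨ σF<xF′+h ⟩
      x * fib (5 + N) + fib (suc (4 + N ∸ k)) ≤⟨ +-monoʳ-≤ _ (fib-mono (s≤s (∸-monoʳ-≤ (4 + N) 2≤k))) ⟩
      x * fib (5 + N) + fib (3 + N)           ≡⟨ +-comm _ (fib (3 + N)) ⟩
      fib (3 + N) + x * fib (5 + N)           ∎)

zeckendorf-odd-head : ∀ {k rest} → ZeckValid (k ∷ rest) → even k ≡ false → FracIn° ⟨0⟩ ⟨φ⁻²⟩ (zval (k ∷ rest))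
zeckendorf-odd-head {k} {rest} (2≤k , gaps) odd-k = σ , x , bounds
  where
  x = zval (k ∷ rest)
  σ = zval⁺ (k ∷ rest)
  3≤k : 3 ≤ k
  3≤k = ≤∧≢⇒< 2≤k λ { refl → case odd-k of λ () }
  bounds : ∀ N → x ≤ N → Within° ⟨0⟩ ⟨φ⁻²⟩ x σ N
  bounds N x≤N with zeckendorf-at-level N gaps odd-k x≤N
  ... | identity , lower , upper with between-by-offset (sym identity) (≤-<-trans (m≤m+n _ _) lower) upper
  ... | σF<xF′ , xF′<σF+h = within° σF<xF′ (begin-strict
    x * fib (5 + N)                         <⟨ xF′<σF+h ⟩
    σ * fib (4 + N) + fib (suc (4 + N ∸ k)) ≤⟨ +-monoʳ-≤ _ (fib-mono (s≤s (∸-monoʳ-≤ (4 + N) 3≤k))) ⟩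
    σ * fib (4 + N) + fib (2 + N)           ≡⟨ +-comm (σ * fib (4 + N)) (fib (2 + N)) ⟩
    fib (2 + N) + σ * fib (4 + N)           ∎)
    where open ≤-Reasoning

-- Chung–Graham representations

digitAt-snoc-≤ : ∀ cs d {j} → j ≤ length cs → digitAt (cs ++ [ d ]) j ≡ digitAt cs j
digitAt-snoc-≤ [] d {zero} _ = refl
digitAt-snoc-≤ (c ∷ cs) d {zero} _ = refl
digitAt-snoc-≤ (c ∷ cs) d {suc zero} _ = refl
digitAt-snoc-≤ (c ∷ cs) d {suc (suc j)} (s≤s j<) = digitAt-snoc-≤ cs d j<

digitAt-snoc-last : ∀ cs d → digitAt (cs ++ [ d ]) (suc (length cs)) ≡ d
digitAt-snoc-last [] d = refl
digitAt-snoc-last (c ∷ cs) d = digitAt-snoc-last cs d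

digitAt-snoc-> : ∀ cs d {j} → suc (length cs) < j → digitAt (cs ++ [ d ]) j ≡ 0
digitAt-snoc-> [] d {suc zero} (s≤s ())
digitAt-snoc-> [] d {suc (suc j)} _ = refl
digitAt-snoc-> (c ∷ cs) d {suc (suc j)} (s≤s j>) = digitAt-snoc-> cs d j>

AllLe2-snoc : ∀ cs {d} → AllLe2 cs → d ≤ 2 → AllLe2 (cs ++ [ d ])
AllLe2-snoc [] _ d≤2 = d≤2 , tt
AllLe2-snoc (c ∷ cs) (c≤2 , cs≤2) d≤2 = c≤2 , AllLe2-snoc cs cs≤2 d≤2

cgvalFrom-snoc : ∀ j cs d → cgvalFrom j (cs ++ [ d ]) ≡ cgvalFrom j cs + d * fib (2 * (j + length cs))
cgvalFrom-snoc j [] d = trans (+-identityʳ _) (cong (λ i → d * fib (2 * i)) (sym (+-identityʳ j)))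
cgvalFrom-snoc j (c ∷ cs) d rewrite cgvalFrom-snoc (suc j) cs d | +-suc j (length cs) =
  sym (+-assoc (c * fib (2 * j)) _ _)

length-snoc : ∀ (cs : List ℕ) d → length (cs ++ [ d ]) ≡ suc (length cs)
length-snoc cs d = trans (length-++ cs) (+-comm (length cs) 1)

TwosResolved : List ℕ → Set
TwosResolved cs = ∀ j → 1 ≤ j → digitAt cs j ≡ 2 → ∃[ j″ ] (j < j″ × j″ ≤ length cs × digitAt cs j″ ≡ 0)

digitAt-snoc-≡2 : ∀ cs d j → digitAt (cs ++ [ d ]) j ≡ 2 →
  (j ≤ length cs × digitAt cs j ≡ 2) ⊎ (j ≡ suc (length cs) × d ≡ 2)
digitAt-snoc-≡2 cs d j cⱼ≡2 with <-cmp j (suc (length cs))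
... | tri< j≤n _ _ = inj₁ (≤-pred j≤n , trans (sym (digitAt-snoc-≤ cs d (≤-pred j≤n))) cⱼ≡2)
... | tri≈ _ refl _ = inj₂ (refl , trans (sym (digitAt-snoc-last cs d)) cⱼ≡2)
... | tri> _ _ j>n with trans (sym (digitAt-snoc-> cs d j>n)) cⱼ≡2
...   | ()

CGCond-snoc : ∀ cs d → CGCond cs → (d ≡ 2 → TwosResolved cs) → CGCond (cs ++ [ d ])
CGCond-snoc cs d cond resolved j j′ 1≤j j<j′ cⱼ≡2 cⱼ′≡2 with digitAt-snoc-≡2 cs d j′ cⱼ′≡2
... | inj₁ (j′≤n , c′≡2)
  with cond j j′ 1≤j j<j′ (trans (sym (digitAt-snoc-≤ cs d (≤-trans (<⇒≤ j<j′) j′≤n))) cⱼ≡2) c′≡2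
...   | j″ , j<j″ , j″<j′ , cⱼ″≡0 =
  j″ , j<j″ , j″<j′ , trans (digitAt-snoc-≤ cs d (≤-trans (<⇒≤ j″<j′) j′≤n)) cⱼ″≡0
CGCond-snoc cs d cond resolved j j′ 1≤j j<j′ cⱼ≡2 cⱼ′≡2 | inj₂ (refl , d≡2)
  with resolved d≡2 j 1≤j (trans (sym (digitAt-snoc-≤ cs d (≤-pred j<j′))) cⱼ≡2)
...   | j″ , j<j″ , j″≤n , cⱼ″≡0 = j″ , j<j″ , s≤s j″≤n , trans (digitAt-snoc-≤ cs d j″≤n) cⱼ″≡0

TwosResolved-snoc-0 : ∀ cs → TwosResolved (cs ++ [ 0 ])
TwosResolved-snoc-0 cs j 1≤j cⱼ≡2 with digitAt-snoc-≡2 cs 0 j cⱼ≡2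
... | inj₁ (j≤n , _) = suc (length cs) , s≤s j≤n , ≤-reflexive (sym (length-snoc cs 0)) , digitAt-snoc-last cs 0
... | inj₂ (_ , ())

TwosResolved-snoc-1 : ∀ cs → TwosResolved cs → TwosResolved (cs ++ [ 1 ])
TwosResolved-snoc-1 cs resolved j 1≤j cⱼ≡2 with digitAt-snoc-≡2 cs 1 j cⱼ≡2
... | inj₂ (_ , ())
... | inj₁ (j≤n , c≡2) with resolved j 1≤j c≡2
...   | j″ , j<j″ , j″≤n , cⱼ″≡0 =
  j″ , j<j″ , ≤-trans j″≤n (≤-trans (n≤1+n _) (≤-reflexive (sym (length-snoc cs 1)))) ,
  trans (digitAt-snoc-≤ cs 1 j″≤n) cⱼ″≡0

evenFib : ℕ → ℕ
evenFib j = fib (2 * j)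

evenFib-recurrence : ∀ J → evenFib (2 + J) + evenFib J ≡ 3 * evenFib (1 + J)
evenFib-recurrence J = begin
  fib (2 * (2 + J)) + fib (2 * J) ≡⟨ cong (λ i → fib i + fib (2 * J)) (double-2+ J) ⟩
  fib (4 + 2 * J) + fib (2 * J)   ≡⟨ unfold (fib (2 * J)) (fib (1 + 2 * J)) ⟩
  3 * fib (2 + 2 * J)             ≡⟨ cong (λ i → 3 * fib i) (sym (double-1+ J)) ⟩
  3 * fib (2 * (1 + J))           ∎
  where
  open ≡-Reasoning
  double-2+ : ∀ J → 2 * (2 + J) ≡ 4 + 2 * J
  double-2+ = solve-∀
  double-1+ : ∀ J → 2 * (1 + J) ≡ 2 + 2 * J
  double-1+ = solve-∀
  unfold : ∀ a b → b + a + b + (b + a) + a ≡ 3 * (b + a)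
  unfold = solve-∀

below-third : ∀ {a g} → a + (g + g) < 3 * g → a < g
below-third {a} {g} a+2g<3g = +-cancelʳ-< (g + g) a g (subst (a + (g + g) <_) (triple g) a+2g<3g)
  where
  triple : ∀ g → 3 * g ≡ g + (g + g)
  triple = solve-∀

ChungGrahamRep : ℕ → ℕ → Set
ChungGrahamRep J x =
  ∃[ cs ] (length cs ≡ J × CGValid cs × cgval cs ≡ x × (x + evenFib J < evenFib (suc J) → TwosResolved cs))

ChungGrahamBelow : ℕ → Set
ChungGrahamBelow J = ∀ x → x < evenFib (suc J) → ChungGrahamRep J x

append-digit : ∀ {J x} cs d → d ≤ 2 → length cs ≡ J → CGValid cs → cgval cs + d * evenFib (suc J) ≡ x →
  (d ≡ 2 → TwosResolved cs) → (x + evenFib (suc J) < evenFib (2 + J) → TwosResolved (cs ++ [ d ])) →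
  ChungGrahamRep (suc J) x
append-digit cs d d≤2 refl (cs≤2 , cond) val resolved resolved′ =
  cs ++ [ d ] , length-snoc cs d , (AllLe2-snoc cs cs≤2 d≤2 , CGCond-snoc cs d cond resolved) ,
  trans (cgvalFrom-snoc 1 cs d) val , resolved′

top-digit-0 : ∀ J → ChungGrahamBelow J → ∀ x → x < evenFib (suc J) → ChungGrahamRep (suc J) x
top-digit-0 J below x x<g₁ with below x x<g₁
... | cs , len , valid , val , _ =
  append-digit cs 0 z≤n len valid (trans (+-identityʳ _) val) (λ ()) (λ _ → TwosResolved-snoc-0 cs)

top-digit-1 : ∀ J → ChungGrahamBelow J → ∀ x → evenFib (suc J) ≤ x → x < evenFib (suc J) + evenFib (suc J) →
  ChungGrahamRep (suc J) x
top-digit-1 J below x g₁≤x x<2g₁ with below (x ∸ evenFib (suc J)) (n≤m<n+o⇒m∸n<o g₁≤x x<2g₁)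
... | cs , len , valid , val , resolved =
  append-digit cs 1 (s≤s z≤n) len valid (trans (cong₂ _+_ val (*-identityˡ g₁)) r+g₁≡x) (λ ()) resolved′
  where
  open ≤-Reasoning
  g₀ = evenFib J
  g₁ = evenFib (suc J)
  r = x ∸ g₁
  r+g₁≡x : r + g₁ ≡ x
  r+g₁≡x = m∸n+n≡m g₁≤x
  resolved′ : x + g₁ < evenFib (2 + J) → TwosResolved (cs ++ [ 1 ])
  resolved′ x+g₁<g₂ = TwosResolved-snoc-1 cs (resolved (below-third (begin-strict
    r + g₀ + (g₁ + g₁)   ≡⟨ regroup r g₀ g₁ ⟩
    r + g₁ + g₁ + g₀     ≡⟨ cong (λ y → y + g₁ + g₀) r+g₁≡x ⟩
    x + g₁ + g₀          <⟨ +-monoˡ-< g₀ x+g₁<g₂ ⟩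
    evenFib (2 + J) + g₀ ≡⟨ evenFib-recurrence J ⟩
    3 * g₁               ∎)))
    where
    regroup : ∀ r g₀ g₁ → r + g₀ + (g₁ + g₁) ≡ r + g₁ + g₁ + g₀
    regroup = solve-∀

-- the rest r = x − 2 F_{2J+2} satisfies r + F_{2J} < F_{2J+2}, as F_{2J+4} + F_{2J} = 3 F_{2J+2},
-- so its representation is TwosResolved and accepts a top digit 2
top-digit-2 : ∀ J → ChungGrahamBelow J → ∀ x → evenFib (suc J) + evenFib (suc J) ≤ x → x < evenFib (2 + J) →
  ChungGrahamRep (suc J) x
top-digit-2 J below x 2g₁≤x x<g₂ = extend (below r (≤-<-trans (m≤m+n r g₀) r+g₀<g₁))
  where
  open ≤-Reasoning
  g₀ = evenFib J
  g₁ = evenFib (suc J)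
  r = x ∸ (g₁ + g₁)
  r+g₀<g₁ : r + g₀ < g₁
  r+g₀<g₁ = below-third (begin-strict
    r + g₀ + (g₁ + g₁)   ≡⟨ xy∙z≈xz∙y r g₀ (g₁ + g₁) ⟩
    r + (g₁ + g₁) + g₀   ≡⟨ cong (_+ g₀) (m∸n+n≡m 2g₁≤x) ⟩
    x + g₀               <⟨ +-monoˡ-< g₀ x<g₂ ⟩
    evenFib (2 + J) + g₀ ≡⟨ evenFib-recurrence J ⟩
    3 * g₁               ∎)
  g₂≤x+g₁ : evenFib (2 + J) ≤ x + g₁
  g₂≤x+g₁ = begin
    evenFib (2 + J)      ≤⟨ m≤m+n _ g₀ ⟩
    evenFib (2 + J) + g₀ ≡⟨ evenFib-recurrence J ⟩
    3 * g₁               ≡⟨ triple g₁ ⟩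
    g₁ + g₁ + g₁         ≤⟨ +-monoˡ-≤ g₁ 2g₁≤x ⟩
    x + g₁               ∎
    where
    triple : ∀ g → 3 * g ≡ g + g + g
    triple = solve-∀
  extend : ChungGrahamRep J r → ChungGrahamRep (suc J) x
  extend (cs , len , valid , val , resolved) =
    append-digit cs 2 ≤-refl len valid (trans (cong₂ _+_ val (cong (g₁ +_) (+-identityʳ g₁))) (m∸n+n≡m 2g₁≤x))
      (λ _ → resolved r+g₀<g₁) (λ x+g₁<g₂ → ⊥-elim (<⇒≱ x+g₁<g₂ g₂≤x+g₁))

chungGraham-below : ∀ J → ChungGrahamBelow J
chungGraham-below zero zero _ = [] , refl , (tt , λ _ _ _ _ ()) , refl , λ _ _ _ ()
chungGraham-below zero (suc x) (s≤s ())
chungGraham-below (suc J) x x<g₂ with x <? evenFib (suc J)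
... | yes x<g₁ = top-digit-0 J (chungGraham-below J) x x<g₁
... | no x≮g₁ with x <? evenFib (suc J) + evenFib (suc J)
...   | yes x<2g₁ = top-digit-1 J (chungGraham-below J) x (≮⇒≥ x≮g₁) x<2g₁
...   | no x≮2g₁ = top-digit-2 J (chungGraham-below J) x (≮⇒≥ x≮2g₁) x<g₂

chungGraham-exists : ∀ x → ∃[ cs ] (CGValid cs × cgval cs ≡ x)
chungGraham-exists x with chungGraham-below x x (<-≤-trans (n<fib[2+n] x) (fib-mono 2+x≤2[1+x]))
  where
  2+x≤2[1+x] : 2 + x ≤ 2 * suc x
  2+x≤2[1+x] = s≤s (subst (suc x ≤_) (cong (λ t → x + suc t) (sym (+-identityʳ x))) (m≤n+m (suc x) x))
... | cs , _ , valid , val , _ = cs , valid , val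

cgvalFrom⁺ : ℕ → List ℕ → ℕ
cgvalFrom⁺ j [] = 0
cgvalFrom⁺ j (c ∷ cs) = c * fib (suc (2 * j)) + cgvalFrom⁺ (suc j) cs

cgDefect : ℕ → List ℕ → ℕ
cgDefect u [] = 0
cgDefect u (c ∷ cs) = c * fib u + cgDefect (u ∸ 2) cs

double-suc-≤ : ∀ {n u} → 2 * suc n ≤ u → ∃[ u′ ] (u ≡ 2 + u′ × 2 * n ≤ u′)
double-suc-≤ {n} {suc (suc u′)} le = u′ , refl , ≤-pred (≤-pred (subst (_≤ 2 + u′) (*-suc 2 n) le))
double-suc-≤ {n} {zero} le with subst (_≤ 0) (*-suc 2 n) le
... | ()
double-suc-≤ {n} {suc zero} le with subst (_≤ 1) (*-suc 2 n) le
... | s≤s ()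

-- d'Ocagne at the even index 2j: F_{2j+1} F_{2j+u} − F_{2j} F_{2j+u+1} = F_u, summed over the digits
chungGraham-d'Ocagne : ∀ j u cs → 2 * length cs ≤ u →
  cgvalFrom⁺ j cs * fib (2 * j + u) ≡ cgvalFrom j cs * fib (suc (2 * j + u)) + cgDefect u cs
chungGraham-d'Ocagne j u [] _ = refl
chungGraham-d'Ocagne j u (c ∷ cs) 2n≤u with double-suc-≤ 2n≤u
... | u′ , refl , 2n≤u′ = begin
  (c * fib (suc (2 * j)) + cgvalFrom⁺ (suc j) cs) * F
    ≡⟨ distrib c (fib (suc (2 * j))) (cgvalFrom⁺ (suc j) cs) F ⟩
  c * (fib (suc (2 * j)) * F) + cgvalFrom⁺ (suc j) cs * F
    ≡⟨ cong₂ (λ a b → c * a + b) digit tail ⟩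
  c * (fib (2 * j) * F′ + fib (2 + u′)) + (cgvalFrom (suc j) cs * F′ + cgDefect u′ cs)
    ≡⟨ collect c (fib (2 * j)) F′ (fib (2 + u′)) (cgvalFrom (suc j) cs) (cgDefect u′ cs) ⟩
  (c * fib (2 * j) + cgvalFrom (suc j) cs) * F′ + (c * fib (2 + u′) + cgDefect u′ cs) ∎
  where
  open ≡-Reasoning
  F = fib (2 * j + (2 + u′))
  F′ = fib (suc (2 * j + (2 + u′)))
  shift : ∀ j u′ → 2 * suc j + u′ ≡ 2 * j + (2 + u′)
  shift = solve-∀
  digit : fib (suc (2 * j)) * F ≡ fib (2 * j) * F′ + fib (2 + u′)
  digit = subst (λ e → SignedDiff e (fib (suc (2 * j)) * F) (fib (2 * j) * F′) (fib (2 + u′))) (even-2* j)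
                (d'Ocagne (2 * j) (2 + u′))
  tail : cgvalFrom⁺ (suc j) cs * F ≡ cgvalFrom (suc j) cs * F′ + cgDefect u′ cs
  tail = subst (λ i → cgvalFrom⁺ (suc j) cs * fib i ≡ cgvalFrom (suc j) cs * fib (suc i) + cgDefect u′ cs)
               (shift j u′)
               (chungGraham-d'Ocagne (suc j) u′ cs 2n≤u′)
  distrib : ∀ c a w F → (c * a + w) * F ≡ c * (a * F) + w * F
  distrib = solve-∀
  collect : ∀ c b F′ f w d → c * (b * F′ + f) + (w * F′ + d) ≡ (c * b + w) * F′ + (c * f + d)
  collect = solve-∀

TwosGuarded : List ℕ → Set
TwosGuarded cs = ∀ j → 1 ≤ j → digitAt cs j ≡ 2 → ∃[ j″ ] (1 ≤ j″ × j″ < j × digitAt cs j″ ≡ 0)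

CGCond-tail : ∀ c cs → CGCond (c ∷ cs) → CGCond cs
CGCond-tail c cs cond (suc j) (suc j′) _ (s≤s j<j′) cⱼ≡2 cⱼ′≡2
  with cond (2 + j) (2 + j′) (s≤s z≤n) (s≤s (s≤s j<j′)) cⱼ≡2 cⱼ′≡2
... | suc (suc j″) , s≤s (s≤s j<j″) , s≤s j″<j′ , cⱼ″≡0 = suc j″ , s≤s j<j″ , j″<j′ , cⱼ″≡0
... | suc zero , s≤s () , _
... | zero , () , _

CGCond-2∷⇒TwosGuarded : ∀ cs → CGCond (2 ∷ cs) → TwosGuarded cs
CGCond-2∷⇒TwosGuarded cs cond (suc j) _ cⱼ≡2 with cond 1 (2 + j) (s≤s z≤n) (s≤s (s≤s z≤n)) refl cⱼ≡2
... | suc (suc j″) , _ , s≤s j″<j , cⱼ″≡0 = suc j″ , s≤s z≤n , j″<j , cⱼ″≡0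
... | suc zero , s≤s () , _
... | zero , () , _

TwosGuarded-1∷ : ∀ cs → TwosGuarded (1 ∷ cs) → TwosGuarded cs
TwosGuarded-1∷ cs guarded (suc j) _ cⱼ≡2 with guarded (2 + j) (s≤s z≤n) cⱼ≡2
... | suc (suc j″) , _ , s≤s j″<j , cⱼ″≡0 = suc j″ , s≤s z≤n , j″<j , cⱼ″≡0
... | suc zero , _ , _ , ()
... | zero , () , _

¬TwosGuarded-2∷ : ∀ cs → ¬ TwosGuarded (2 ∷ cs)
¬TwosGuarded-2∷ cs guarded with guarded 1 (s≤s z≤n) refl
... | _ , 1≤j″ , j″<1 , _ = <⇒≱ j″<1 1≤j″

cgDefect-bound : ∀ u cs → 2 * length cs ≤ u → AllLe2 cs → CGCond cs →
  cgDefect u cs < fib (2 + u) × (TwosGuarded cs → cgDefect u cs < fib (1 + u))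
cgDefect-bound u [] _ _ _ = fib-pos (suc u) , λ _ → fib-pos u
cgDefect-bound u (c ∷ cs) 2n≤u (c≤2 , cs≤2) cond with double-suc-≤ 2n≤u
... | u′ , refl , 2n≤u′ = digit-case c c≤2 cond
  where
  open ≤-Reasoning
  D = cgDefect u′ cs
  F₁ = fib (1 + u′)
  F₂ = fib (2 + u′)
  IH = cgDefect-bound u′ cs 2n≤u′ cs≤2 (CGCond-tail c cs cond)
  digit-case : ∀ c → c ≤ 2 → CGCond (c ∷ cs) →
    c * F₂ + D < fib (4 + u′) × (TwosGuarded (c ∷ cs) → c * F₂ + D < fib (3 + u′))
  digit-case zero _ _ =
    <-≤-trans (proj₁ IH) (≤-trans (fib-≤-suc (2 + u′)) (fib-≤-suc (3 + u′))) ,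
    λ _ → <-≤-trans (proj₁ IH) (fib-≤-suc (2 + u′))
  digit-case (suc zero) _ _ =
    subst (_< fib (4 + u′)) (cong (_+ D) (sym (*-identityˡ F₂))) (+-mono-≤-< (fib-≤-suc (2 + u′)) (proj₁ IH)) ,
    λ guarded → subst (_< fib (3 + u′)) (cong (_+ D) (sym (*-identityˡ F₂)))
                      (+-monoʳ-< F₂ (proj₂ IH (TwosGuarded-1∷ cs guarded)))
  digit-case (suc (suc zero)) _ cond₂ = (begin-strict
    2 * F₂ + D  <⟨ +-monoʳ-< (2 * F₂) (proj₂ IH (CGCond-2∷⇒TwosGuarded cs cond₂)) ⟩
    2 * F₂ + F₁ ≡⟨ regroup F₂ F₁ ⟩
    F₂ + F₁ + F₂ ∎) , λ guarded → ⊥-elim (¬TwosGuarded-2∷ cs guarded)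
    where
    regroup : ∀ a b → 2 * a + b ≡ a + b + a
    regroup = solve-∀
  digit-case (suc (suc (suc _))) (s≤s (s≤s ())) _

cgvalFrom≤cgvalFrom⁺ : ∀ j cs → cgvalFrom j cs ≤ cgvalFrom⁺ j cs
cgvalFrom≤cgvalFrom⁺ j [] = z≤n
cgvalFrom≤cgvalFrom⁺ j (c ∷ cs) = +-mono-≤ (*-monoʳ-≤ c (fib-≤-suc (2 * j))) (cgvalFrom≤cgvalFrom⁺ (suc j) cs)

chungGraham-head-0 : ∀ {tail} → CGValid (0 ∷ tail) → 1 ≤ cgval (0 ∷ tail) → FracIn ⟨φ⁻¹⟩ ⟨1⟩ (cgval (0 ∷ tail))
chungGraham-head-0 {tail} ((_ , tail≤2) , cond) 1≤W = M , 2 * length tail , bounds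
  where
  W = cgvalFrom 2 tail
  W⁺ = cgvalFrom⁺ 2 tail
  M = W⁺ ∸ 1
  W⁺≡1+M : W⁺ ≡ suc M
  W⁺≡1+M = sym (m+[n∸m]≡n (≤-trans 1≤W (cgvalFrom≤cgvalFrom⁺ 2 tail)))
  bounds : ∀ N → 2 * length tail ≤ N → Within ⟨φ⁻¹⟩ ⟨1⟩ W M N
  bounds N 2n≤N
    with shifted-within identity (proj₁ (cgDefect-bound N tail 2n≤N tail≤2 (CGCond-tail 0 tail cond))) ≤-refl
    where
    open ≡-Reasoning
    F = fib (4 + N)
    identity : W * fib (5 + N) + cgDefect N tail ≡ fib (3 + N) + M * F + fib (2 + N)
    identity = begin
      W * fib (5 + N) + cgDefect N tail ≡⟨ sym (chungGraham-d'Ocagne 2 N tail 2n≤N) ⟩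
      W⁺ * F                            ≡⟨ cong (_* F) W⁺≡1+M ⟩
      fib (3 + N) + fib (2 + N) + M * F ≡⟨ xy∙z≈xz∙y (fib (3 + N)) (fib (2 + N)) (M * F) ⟩
      fib (3 + N) + M * F + fib (2 + N) ∎
  ... | lower , upper =
    within lower (≤-trans upper (≤-reflexive (xy∙z≈xz∙y (fib (3 + N)) (M * fib (4 + N)) (fib (2 + N)))))

chungGraham-head-1 : ∀ {tail} → CGValid (1 ∷ tail) → FracIn ⟨0⟩ ⟨φ⁻¹⟩ (cgval (1 ∷ tail))
chungGraham-head-1 {tail} ((_ , tail≤2) , cond) = suc W⁺ , 2 * length tail , bounds
  where
  W = cgvalFrom 2 tail
  W⁺ = cgvalFrom⁺ 2 tail
  bounds : ∀ N → 2 * length tail ≤ N → Within ⟨0⟩ ⟨φ⁻¹⟩ (suc W) (suc W⁺) N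
  bounds N 2n≤N
    with shifted-within identity
           (<-≤-trans (proj₁ (cgDefect-bound N tail 2n≤N tail≤2 (CGCond-tail 1 tail cond))) (fib-≤-suc (2 + N)))
           ≤-refl
    where
    open ≡-Reasoning
    F = fib (4 + N)
    identity : suc W * fib (5 + N) + cgDefect N tail ≡ suc W⁺ * F + fib (3 + N)
    identity = begin
      fib (5 + N) + W * fib (5 + N) + cgDefect N tail   ≡⟨ +-assoc (fib (5 + N)) _ _ ⟩
      fib (5 + N) + (W * fib (5 + N) + cgDefect N tail)
        ≡⟨ cong (fib (5 + N) +_) (sym (chungGraham-d'Ocagne 2 N tail 2n≤N)) ⟩
      F + fib (3 + N) + W⁺ * F                          ≡⟨ xy∙z≈xz∙y F (fib (3 + N)) (W⁺ * F) ⟩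
      F + W⁺ * F + fib (3 + N)                          ∎
  ... | lower , upper = within lower (≤-trans upper (≤-reflexive (+-comm (suc W⁺ * fib (4 + N)) (fib (3 + N)))))

chungGraham-head-2 : ∀ {tail} → CGValid (2 ∷ tail) → FracIn ⟨0⟩ ⟨φ⁻¹⟩ (cgval (2 ∷ tail))
chungGraham-head-2 {tail} ((_ , tail≤2) , cond) = 3 + W⁺ , 2 * length tail , bounds
  where
  W = cgvalFrom 2 tail
  W⁺ = cgvalFrom⁺ 2 tail
  bounds : ∀ N → 2 * length tail ≤ N → Within ⟨0⟩ ⟨φ⁻¹⟩ (2 + W) (3 + W⁺) N
  bounds N 2n≤N with shifted-within identity
                       (proj₂ (cgDefect-bound N tail 2n≤N tail≤2 (CGCond-tail 2 tail cond)) (CGCond-2∷⇒TwosGuarded tail cond))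
                       (≤-trans (fib-≤-suc (1 + N)) (fib-≤-suc (2 + N)))
    where
    open ≡-Reasoning
    F = fib (4 + N)
    -- uses 2 F_{N+5} = 3 F_{N+4} + F_{N+1}
    identity : (2 + W) * fib (5 + N) + cgDefect N tail ≡ (3 + W⁺) * F + fib (1 + N)
    identity = begin
      fib (5 + N) + (fib (5 + N) + W * fib (5 + N)) + cgDefect N tail
        ≡⟨ split (fib (5 + N)) (W * fib (5 + N)) (cgDefect N tail) ⟩
      fib (5 + N) + fib (5 + N) + (W * fib (5 + N) + cgDefect N tail)
        ≡⟨ cong (fib (5 + N) + fib (5 + N) +_) (sym (chungGraham-d'Ocagne 2 N tail 2n≤N)) ⟩
      fib (5 + N) + fib (5 + N) + W⁺ * F
        ≡⟨ twice-F₅ (fib (1 + N)) (fib (2 + N)) (W⁺ * F) ⟩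
      F + (F + (F + W⁺ * F)) + fib (1 + N) ∎
      where
      split : ∀ a w d → a + (a + w) + d ≡ (a + a) + (w + d)
      split = solve-∀
      twice-F₅ : ∀ a b t → (b + a + b + (b + a)) + (b + a + b + (b + a)) + t ≡
                           (b + a + b) + ((b + a + b) + ((b + a + b) + t)) + a
      twice-F₅ = solve-∀
  ... | lower , upper = within lower (≤-trans upper (≤-reflexive (+-comm ((3 + W⁺) * fib (4 + N)) (fib (3 + N)))))

chungGraham-head-nonzero : ∀ {c tail} → CGValid (c ∷ tail) → c ≢ 0 → FracIn ⟨0⟩ ⟨φ⁻¹⟩ (cgval (c ∷ tail))
chungGraham-head-nonzero {zero} _ c≢0 = ⊥-elim (c≢0 refl)
chungGraham-head-nonzero {suc zero} valid _ = chungGraham-head-1 valid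
chungGraham-head-nonzero {suc (suc zero)} valid _ = chungGraham-head-2 valid
chungGraham-head-nonzero {suc (suc (suc _))} ((s≤s (s≤s ()) , _) , _) _

-- The set { 2⌊nφ⌋ + n + 1 : n ≥ 0 }

-- The Fibonacci form of x φ⁴ + n φ = M φ³ + φ² + m for x = 2m + n + 1 and M = 3m + 2n + 1,
-- that is of x φ − M = φ⁻¹ − φ⁻³ (n φ − m): so x φ − M ∈ (φ⁻², φ⁻¹] iff n φ − m ∈ [0, 1).
S-identity : ∀ m n N → (2 * m + n + 1) * fib (8 + N) + n * fib (5 + N) ≡
                       (3 * m + 2 * n + 1) * fib (7 + N) + fib (6 + N) + m * fib (4 + N)
S-identity m n N = expand m n (fib (4 + N)) (fib (5 + N))
  where
  expand : ∀ m n a b → (2 * m + n + 1) * (b + a + b + (b + a)) + n * b ≡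
                       (3 * m + 2 * n + 1) * (b + a + b) + (b + a) + m * a
  expand = solve-∀

window-forward : ∀ {X Y P Q a b} → X + P ≡ Y + (a + b) + Q → Q ≤ P → P < b + Q → a + Y < X × X ≤ (a + b) + Y
window-forward {X} {Y} {P} {Q} {a} {b} identity Q≤P P<b+Q =
  +-cancelʳ-< P (a + Y) X (begin-strict
    a + Y + P       <⟨ +-monoʳ-< (a + Y) P<b+Q ⟩
    a + Y + (b + Q) ≡⟨ regroup a Y b Q ⟩
    Y + (a + b) + Q ≡⟨ sym identity ⟩
    X + P           ∎) ,
  +-cancelʳ-≤ P X (a + b + Y) (begin
    X + P           ≡⟨ identity ⟩
    Y + (a + b) + Q ≤⟨ +-monoʳ-≤ (Y + (a + b)) Q≤P ⟩
    Y + (a + b) + P ≡⟨ cong (_+ P) (+-comm Y (a + b)) ⟩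
    a + b + Y + P   ∎)
  where
  open ≤-Reasoning
  regroup : ∀ a Y b Q → a + Y + (b + Q) ≡ Y + (a + b) + Q
  regroup = solve-∀

window-backward : ∀ {X Y P Q a b} → X + P ≡ Y + (a + b) + Q → a + Y < X → X ≤ (a + b) + Y → Q ≤ P × P < b + Q
window-backward {X} {Y} {P} {Q} {a} {b} identity a+Y<X X≤a+b+Y =
  +-cancelˡ-≤ (Y + (a + b)) Q P (begin
    Y + (a + b) + Q ≡⟨ sym identity ⟩
    X + P           ≤⟨ +-monoˡ-≤ P X≤a+b+Y ⟩
    a + b + Y + P   ≡⟨ cong (_+ P) (+-comm (a + b) Y) ⟩
    Y + (a + b) + P ∎) ,
  +-cancelˡ-< (a + Y) P (b + Q) (begin-strict
    a + Y + P       <⟨ +-monoˡ-< P a+Y<X ⟩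
    X + P           ≡⟨ identity ⟩
    Y + (a + b) + Q ≡⟨ sym (regroup a Y b Q) ⟩
    a + Y + (b + Q) ∎)
  where
  open ≤-Reasoning
  regroup : ∀ a Y b Q → a + Y + (b + Q) ≡ Y + (a + b) + Q
  regroup = solve-∀

approxFloor⇒Within : ∀ {m n N} → ApproxFloor n m N → Within ⟨φ⁻²⟩ ⟨φ⁻¹⟩ (2 * m + n + 1) (3 * m + 2 * n + 1) (3 + N)
approxFloor⇒Within {m} {n} {N} (approxFloor lower upper) =
  uncurry within (window-forward {a = fib (5 + N)} {b = fib (4 + N)} (S-identity m n N) lower upper)

Within⇒approxFloor : ∀ {m n N} → Within ⟨φ⁻²⟩ ⟨φ⁻¹⟩ (2 * m + n + 1) (3 * m + 2 * n + 1) (3 + N) → ApproxFloor n m N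
Within⇒approxFloor {m} {n} {N} (within above below) =
  uncurry approxFloor (window-backward {a = fib (5 + N)} {b = fib (4 + N)} (S-identity m n N) above below)

Within°⇒approxFloor : ∀ {lo hi n M N} → hi ≤ᶜ ⟨1⟩ → Within° lo hi n M N → ApproxFloor n M N
Within°⇒approxFloor {lo} {hi} {N = N} hi≤1 (within° above below) =
  approxFloor (≤-trans (m≤n+m _ (lo N)) (<⇒≤ above)) (<-≤-trans below (+-monoˡ-≤ _ (hi≤1 N)))

FracIn°⇒approxFloor : ∀ {lo hi n} → hi ≤ᶜ ⟨1⟩ → FracIn° lo hi n → ∃[ M ] Eventually (ApproxFloor n M)
FracIn°⇒approxFloor hi≤1 (M , w) = M , eventually-map (Within°⇒approxFloor hi≤1) w

positive⇒approxFloor : ∀ {n} → 1 ≤ n → ∃[ M ] Eventually (ApproxFloor n M)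
positive⇒approxFloor 1≤n with zeckendorf-exists 1≤n
... | k , rest , valid , refl with even k in parity
...   | true  = FracIn°⇒approxFloor ≤ᶜ-refl (zeckendorf-even-head valid parity)
...   | false = FracIn°⇒approxFloor ⟨φ⁻²⟩≤ᶜ⟨1⟩ (zeckendorf-odd-head valid parity)

IsFloorNPhi⇒approx : ∀ {n m} → IsFloorNPhi n m → Eventually (ApproxFloor n m)
IsFloorNPhi⇒approx {zero} {zero} _ = 0 , λ N _ → approxFloor z≤n (subst (0 <_) (sym (+-identityʳ _)) (fib-pos (3 + N)))
IsFloorNPhi⇒approx {zero} {suc m} (() , _)
IsFloorNPhi⇒approx {suc n} {m} floor with positive⇒approxFloor (s≤s (z≤n {n}))
... | M , approx = subst (Eventually ∘ ApproxFloor (suc n))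
                         (IsFloorNPhi-unique {suc n} {M} {m} (approx⇒IsFloorNPhi {suc n} {M} approx) floor) approx

InS⇒FracIn : ∀ {x} → InS x → FracIn ⟨φ⁻²⟩ ⟨φ⁻¹⟩ x
InS⇒FracIn (n , m , floor , refl) =
  3 * m + 2 * n + 1 , eventually-unoffset 3 (eventually-map approxFloor⇒Within (IsFloorNPhi⇒approx {n} {m} floor))

Within⇒M<2x : ∀ {x M N} → Within ⟨φ⁻²⟩ ⟨φ⁻¹⟩ x M N → M < 2 * x
Within⇒M<2x {x} {M} {N} (within above _) = *-cancelʳ-< F M (2 * x) (begin-strict
  M * F               ≤⟨ m≤n+m (M * F) (fib (2 + N)) ⟩
  fib (2 + N) + M * F <⟨ above ⟩
  x * fib (5 + N)     ≤⟨ *-monoʳ-≤ x (+-monoʳ-≤ F (fib-≤-suc (3 + N))) ⟩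
  x * (F + F)         ≡⟨ double x F ⟩
  2 * x * F           ∎)
  where
  open ≤-Reasoning
  F = fib (4 + N)
  double : ∀ x F → x * (F + F) ≡ 2 * x * F
  double = solve-∀

Within⇒3x≤2M+1 : ∀ {x M N} → 1 ≤ x → Within ⟨φ⁻²⟩ ⟨φ⁻¹⟩ x M N → 3 * x ≤ 2 * M + 1
Within⇒3x≤2M+1 {x} {M} {N} 1≤x (within _ below) =
  *-cancelʳ-≤ (3 * x) (2 * M + 1) F {{>-nonZero (fib-pos (3 + N))}} (+-cancelʳ-≤ a _ _ (begin
    3 * x * F + a           ≤⟨ +-monoʳ-≤ (3 * x * F) (subst (_≤ x * a) (*-identityˡ a) (*-monoˡ-≤ a 1≤x)) ⟩
    3 * x * F + x * a       ≡⟨ twice-F₅ x a b ⟩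
    2 * (x * fib (5 + N))   ≤⟨ *-monoʳ-≤ 2 below ⟩
    2 * (fib (3 + N) + M * F) ≡⟨ twice-F₃ M a b ⟩
    (2 * M + 1) * F + a     ∎))
  where
  open ≤-Reasoning
  a = fib (1 + N)
  b = fib (2 + N)
  F = fib (4 + N)
  twice-F₅ : ∀ x a b → 3 * x * (b + a + b) + x * a ≡ 2 * (x * (b + a + b + (b + a)))
  twice-F₅ = solve-∀
  twice-F₃ : ∀ M a b → 2 * (b + a + M * (b + a + b)) ≡ (2 * M + 1) * (b + a + b) + a
  twice-F₃ = solve-∀

-- (m, n) = (2x − M − 1, 2M + 1 − 3x) inverts (x, M) = (2m + n + 1, 3m + 2n + 1)
solve-for-mn : ∀ {x M} → M < 2 * x → 3 * x ≤ 2 * M + 1 →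
  ∃[ m ] ∃[ n ] (x ≡ 2 * m + n + 1 × M ≡ 3 * m + 2 * n + 1)
solve-for-mn {x} {M} M<2x 3x≤2M+1 = m , n , x≡ , M≡
  where
  open ≡-Reasoning
  m = 2 * x ∸ suc M
  n = 2 * M + 1 ∸ 3 * x
  m+1+M≡2x : m + suc M ≡ 2 * x
  m+1+M≡2x = m∸n+n≡m M<2x
  n+3x≡2M+1 : n + 3 * x ≡ 2 * M + 1
  n+3x≡2M+1 = m∸n+n≡m 3x≤2M+1
  x≡ : x ≡ 2 * m + n + 1
  x≡ = +-cancelʳ-≡ (2 * suc M + 3 * x) x (2 * m + n + 1) (begin
    x + (2 * suc M + 3 * x)             ≡⟨ expand₁ x M ⟩
    2 * (2 * x) + (2 * M + 1) + 1       ≡⟨ cong₂ (λ p q → 2 * p + q + 1) (sym m+1+M≡2x) (sym n+3x≡2M+1) ⟩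
    2 * (m + suc M) + (n + 3 * x) + 1   ≡⟨ expand₂ m n M x ⟩
    2 * m + n + 1 + (2 * suc M + 3 * x) ∎)
    where
    expand₁ : ∀ x M → x + (2 * suc M + 3 * x) ≡ 2 * (2 * x) + (2 * M + 1) + 1
    expand₁ = solve-∀
    expand₂ : ∀ m n M x → 2 * (m + suc M) + (n + 3 * x) + 1 ≡ 2 * m + n + 1 + (2 * suc M + 3 * x)
    expand₂ = solve-∀
  M≡ : M ≡ 3 * m + 2 * n + 1
  M≡ = +-cancelʳ-≡ (3 * suc M + 6 * x) M (3 * m + 2 * n + 1) (begin
    M + (3 * suc M + 6 * x)                 ≡⟨ expand₁ x M ⟩
    3 * (2 * x) + 2 * (2 * M + 1) + 1       ≡⟨ cong₂ (λ p q → 3 * p + 2 * q + 1) (sym m+1+M≡2x) (sym n+3x≡2M+1) ⟩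
    3 * (m + suc M) + 2 * (n + 3 * x) + 1   ≡⟨ expand₂ m n M x ⟩
    3 * m + 2 * n + 1 + (3 * suc M + 6 * x) ∎)
    where
    expand₁ : ∀ x M → M + (3 * suc M + 6 * x) ≡ 3 * (2 * x) + 2 * (2 * M + 1) + 1
    expand₁ = solve-∀
    expand₂ : ∀ m n M x → 3 * (m + suc M) + 2 * (n + 3 * x) + 1 ≡ 3 * m + 2 * n + 1 + (3 * suc M + 6 * x)
    expand₂ = solve-∀

InS-from-Within : ∀ {x M} → ∃[ m ] ∃[ n ] (x ≡ 2 * m + n + 1 × M ≡ 3 * m + 2 * n + 1) →
  Eventually (Within ⟨φ⁻²⟩ ⟨φ⁻¹⟩ x M) → InS x
InS-from-Within {x} {M} (m , n , x≡ , M≡) w =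
  n , m , approx⇒IsFloorNPhi {n} {m} (eventually-map level (eventually-offset 3 w)) , x≡
  where
  level : ∀ {N} → Within ⟨φ⁻²⟩ ⟨φ⁻¹⟩ x M (3 + N) → ApproxFloor n m N
  level {N} = Within⇒approxFloor ∘ subst₂ (λ x′ M′ → Within ⟨φ⁻²⟩ ⟨φ⁻¹⟩ x′ M′ (3 + N)) x≡ M≡

FracIn⇒InS : ∀ {x} → FracIn ⟨φ⁻²⟩ ⟨φ⁻¹⟩ x → InS x
FracIn⇒InS {x} (M , w) =
  InS-from-Within (solve-for-mn {x} {M} (Within⇒M<2x w₀) (Within⇒3x≤2M+1 (FracIn⇒positive (M , w)) w₀)) w
  where
  w₀ = proj₂ (eventually-witness w)

-- The three sets as intervals of the fractional part

InFeven⇔FracIn : ∀ {x} → InFeven x ⇔ FracIn ⟨φ⁻²⟩ ⟨1⟩ x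
InFeven⇔FracIn {x} = mk⇔ feven⇒ ⇒feven
  where
  feven⇒ : InFeven x → FracIn ⟨φ⁻²⟩ ⟨1⟩ x
  feven⇒ (h , _ , _ , rest , valid , refl) = FracIn°⇒FracIn (zeckendorf-even-head valid (even-2* h))
  ⇒feven : FracIn ⟨φ⁻²⟩ ⟨1⟩ x → InFeven x
  ⇒feven w with zeckendorf-exists (FracIn⇒positive w)
  ... | k , rest , valid , refl with even k in parity
  ...   | true with even⇒2* k parity
  ...     | suc h , refl = suc h , s≤s z≤n , FracIn⇒positive w , rest , valid , refl
  ...     | zero , refl = ⊥-elim (<⇒≱ (proj₁ valid) z≤n)
  ⇒feven w | k , rest , valid , refl | false =
    ⊥-elim (FracIn-disjoint ⟨φ⁻²⟩≤ᶜ⟨1⟩ ≤ᶜ-refl ≤ᶜ-refl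
              (FracIn°⇒FracIn (zeckendorf-odd-head valid parity)) w)

InB2⇒FracIn : ∀ {x} → InB2 x → FracIn ⟨0⟩ ⟨φ⁻¹⟩ x
InB2⇒FracIn (_ , [] , _ , _ , c₁≢0) = ⊥-elim (c₁≢0 refl)
InB2⇒FracIn (_ , c ∷ tail , valid , refl , c≢0) = chungGraham-head-nonzero valid c≢0

InB2-or-FracIn : ∀ {x} → 1 ≤ x → InB2 x ⊎ FracIn ⟨φ⁻¹⟩ ⟨1⟩ x
InB2-or-FracIn {x} 1≤x with chungGraham-exists x
... | [] , _ , refl = ⊥-elim (<⇒≱ 1≤x z≤n)
... | c ∷ tail , valid , refl with c ≟ 0
...   | yes refl = inj₂ (chungGraham-head-0 valid 1≤x)
...   | no c≢0 = inj₁ (1≤x , c ∷ tail , valid , refl , c≢0)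

InNotB2⇔FracIn : ∀ {x} → InNotB2 x ⇔ FracIn ⟨φ⁻¹⟩ ⟨1⟩ x
InNotB2⇔FracIn {x} = mk⇔ notB2⇒ ⇒notB2
  where
  notB2⇒ : InNotB2 x → FracIn ⟨φ⁻¹⟩ ⟨1⟩ x
  notB2⇒ (1≤x , ¬b2) with InB2-or-FracIn 1≤x
  ... | inj₁ b2 = ⊥-elim (¬b2 b2)
  ... | inj₂ w = w
  ⇒notB2 : FracIn ⟨φ⁻¹⟩ ⟨1⟩ x → InNotB2 x
  ⇒notB2 w =
    FracIn⇒positive w , λ b2 → FracIn-disjoint ⟨φ⁻¹⟩≤ᶜ⟨1⟩ ≤ᶜ-refl ≤ᶜ-refl (InB2⇒FracIn b2) w

InS⇔FracIn : ∀ {x} → InS x ⇔ FracIn ⟨φ⁻²⟩ ⟨φ⁻¹⟩ x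
InS⇔FracIn = mk⇔ InS⇒FracIn FracIn⇒InS

theorem16 : ∀ (x : ℕ) →
    (InFeven x ⇔ (InNotB2 x ⊎ InS x)) × ¬ (InNotB2 x × InS x)
theorem16 x = mk⇔ forward backward , disjoint
  where
  forward : InFeven x → InNotB2 x ⊎ InS x
  forward feven with InB2-or-FracIn (FracIn⇒positive (to InFeven⇔FracIn feven))
  ... | inj₁ b2 =
    inj₂ (from InS⇔FracIn (FracIn-∩ ⟨φ⁻¹⟩≤ᶜ⟨1⟩ ≤ᶜ-refl (InB2⇒FracIn b2) (to InFeven⇔FracIn feven)))
  ... | inj₂ w = inj₁ (from InNotB2⇔FracIn w)
  backward : InNotB2 x ⊎ InS x → InFeven x
  backward (inj₁ notB2) =
    from InFeven⇔FracIn (FracIn-mono ⟨φ⁻²⟩≤ᶜ⟨φ⁻¹⟩ ≤ᶜ-refl (to InNotB2⇔FracIn notB2))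
  backward (inj₂ s) = from InFeven⇔FracIn (FracIn-mono ≤ᶜ-refl ⟨φ⁻¹⟩≤ᶜ⟨1⟩ (to InS⇔FracIn s))
  disjoint : ¬ (InNotB2 x × InS x)
  disjoint (notB2 , s) =
    FracIn-disjoint ⟨φ⁻¹⟩≤ᶜ⟨1⟩ ≤ᶜ-refl ≤ᶜ-refl (to InS⇔FracIn s) (to InNotB2⇔FracIn notB2)
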